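{- Let $(k,m,S,t)$ be an instance of Multidimensional Relaxed Subset Sum with $S=\{s_1,\dots,s_n\}\subseteq\mathbb{N}^k$, $t\in\mathbb{N}^k$, and let $M_i=\max_j s_i(j)$ and $T_j=\sum_{i=1}^n s_i(j)+t(j)$. Construct a graph $G$: for each $j\in[k]$ take vertices $u_j,v_j$, a set $D_j$ of $T_j$ vertices and a set $F_j$ of $\lceil T_j/2\rceil$ vertices; attach two pendant vertices to each vertex of $F_j$; attach one pendant vertex $r_j^1$ to $u_j$ and one pendant vertex $r_j^2$ to $v_j$; make $v_j$ adjacent to every vertex of $D_j\cup F_j$ and $u_j$ adjacent to every vertex of $D_j$. For each $i\in[n]$ take a vertex $a_i$ and, for each $l\in[M_i]$, vertices $b_i^l,c_i^l$ with edge $b_i^lc_i^l$ and edge $a_ib_i^l$; for each $j\in[k]$ make $u_j$ adjacent to exactly $s_i(j)$ (arbitrarily chosen) vertices of $\{c_i^1,\dots,c_i^{M_i}\}$; for each $l\in[M_i]$ attach four pendant vertices to $b_i^l$, add a path $w_i^l x_i^l y_i^l$ with $w_i^l$ adjacent to $b_i^l$, and add vertices $g_i^l,h_i^l,p_i^l,q_i^l$ with edges $c_i^lg_i^l$, $g_i^lh_i^l$, $c_i^lp_i^l$, $p_i^lq_i^l$. Let $k'=\sum_{i=1}^n(3M_i+1)-\sum_{j=1}^k T_j+2k+m$. If $(k,m,S,t)$ is a yes-instance (i.e., there is $S'\subseteq S$ with $|S'|\le m$ and $\sum_{s\in S'}s\ge t$ coordinatewise), then $G$ has a signed Roman dominating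 function of weight at most $k'$.
   Context: Multidimensional Relaxed Subset Sum: given an integer $k$, a set $S$ of $n$ vectors in $\mathbb{N}^k$, a target $t\in\mathbb{N}^k$ and an integer $m$, decide whether some $S'\subseteq S$ with $|S'|\le m$ satisfies $\sum_{s\in S'}s\ge t$ coordinatewise. A signed Roman dominating function of a graph $G=(V,E)$ is a function $f:V\to\{ -1,1,2\}$ such that (i) for every $u\in V$, $\sum_{v\in N[u]} f(v)\ge 1$, and (ii) every vertex $u$ with $f(u)=-1$ has a neighbour $v$ with $f(v)=2$. Its weight is $\sum_{u\in V} f(u)$. A pendant vertex is a new vertex of degree one. All constructed vertices are distinct. -}

module Defs where

open import Data.Nat as ℕ using (ℕ; zero; suc; _⊔_; _≡ᵇ_; ⌈_/2⌉)
open import Data.Integer as ℤ using (ℤ; +_; -_; _≤_)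
open import Data.Fin using (Fin; toℕ; zero; suc)
open import Data.Fin.Subset using (Subset; ∣_∣)
open import Data.Vec using (lookup)
open import Data.Bool using (Bool; true; false; _∧_; _∨_; T; if_then_else_)
open import Data.List using (List; []; _∷_; _++_; map; concatMap; allFin; filterᵇ; foldr)
open import Data.Product using (Σ; ∃; _×_; _,_)
open import Relation.Binary.PropositionalEquality using (_≡_)

sumFin : (k : ℕ) → (Fin k → ℕ) → ℕ
sumFin zero    g = 0
sumFin (suc k) g = g zero ℕ.+ sumFin k (λ j → g (suc j))

maxFin : (k : ℕ) → (Fin k → ℕ) → ℕ
maxFin zero    g = 0
maxFin (suc k) g = g zero ⊔ maxFin k (λ j → g (suc j))

sumℤ : List ℤ → ℤ
sumℤ = foldr ℤ._+_ (+ 0)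

-- Multidimensional Relaxed Subset Sum.
-- S = {s_1,…,s_n} given as an indexed family  S i j = s_i(j),  t j = t(j).

YesInstance : (k n m : ℕ) → (Fin n → Fin k → ℕ) → (Fin k → ℕ) → Set
YesInstance k n m S t =
  Σ (Subset n) λ I →
    (∣ I ∣ ℕ.≤ m) ×
    (∀ (j : Fin k) → t j ℕ.≤ sumFin n (λ i → if lookup I i then S i j else 0))

Mof : {k n : ℕ} → (Fin n → Fin k → ℕ) → Fin n → ℕ
Mof {k} S i = maxFin k (S i)

Tof : {k n : ℕ} → (Fin n → Fin k → ℕ) → (Fin k → ℕ) → Fin k → ℕ
Tof {k} {n} S t j = sumFin n (λ i → S i j) ℕ.+ t j

-- Finite simple graphs given by an explicit vertex enumeration and a
-- (symmetric, loopless) Boolean adjacency.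

record Graph : Set₁ where
  field
    V    : Set
    allV : List V          -- every vertex exactly once
    adj  : V → V → Bool

open Graph public

data Label : Set where
  neg one two : Label

val : Label → ℤ
val neg = - (+ 1)
val one = + 1
val two = + 2

-- Σ_{v ∈ N[u]} f(v)   (u itself plus its neighbours; adjacency is loopless)
closedSum : (G : Graph) → (V G → Label) → V G → ℤ
closedSum G f u = val (f u) ℤ.+ sumℤ (map (λ w → val (f w)) (filterᵇ (adj G u) (allV G)))

IsSRDF : (G : Graph) → (V G → Label) → Set
IsSRDF G f =
  (∀ u → + 1 ≤ closedSum G f u) ×
  (∀ u → f u ≡ neg → ∃ λ w → T (adj G u w) × f w ≡ two)

weight : (G : Graph) → (V G → Label) → ℤ
weight G f = sumℤ (map (λ w → val (f w)) (allV G))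

data Vx (k n : ℕ) (Tj : Fin k → ℕ) (Mi : Fin n → ℕ) : Set where
  uV vV r1 r2 : Fin k → Vx k n Tj Mi
  dV    : (j : Fin k) → Fin (Tj j) → Vx k n Tj Mi
  fV    : (j : Fin k) → Fin ⌈ Tj j /2⌉ → Vx k n Tj Mi
  fpend : (j : Fin k) → Fin ⌈ Tj j /2⌉ → Fin 2 → Vx k n Tj Mi
  aV    : Fin n → Vx k n Tj Mi
  bV cV wV xV yV gV hV pV qV : (i : Fin n) → Fin (Mi i) → Vx k n Tj Mi
  bpend : (i : Fin n) → Fin (Mi i) → Fin 4 → Vx k n Tj Mi

eqF : {a b : ℕ} → Fin a → Fin b → Bool
eqF x y = toℕ x ≡ᵇ toℕ y

-- Edges listed in one direction; C i j ⊆ [M_i] is the chosen set of l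
-- with u_j adjacent to c_i^l.
edge : {k n : ℕ} {Tj : Fin k → ℕ} {Mi : Fin n → ℕ} →
       ((i : Fin n) → Fin k → Subset (Mi i)) →
       Vx k n Tj Mi → Vx k n Tj Mi → Bool
edge C (fpend j x e) (fV j' x')   = eqF j j' ∧ eqF x x'
edge C (r1 j)        (uV j')      = eqF j j'
edge C (r2 j)        (vV j')      = eqF j j'
edge C (vV j)        (dV j' x)    = eqF j j'
edge C (vV j)        (fV j' x)    = eqF j j'
edge C (uV j)        (dV j' x)    = eqF j j'
edge C (uV j)        (cV i l)     = lookup (C i j) l
edge C (aV i)        (bV i' l)    = eqF i i'
edge C (bV i l)      (cV i' l')   = eqF i i' ∧ eqF l l'
edge C (bpend i l e) (bV i' l')   = eqF i i' ∧ eqF l l'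
edge C (wV i l)      (bV i' l')   = eqF i i' ∧ eqF l l'
edge C (wV i l)      (xV i' l')   = eqF i i' ∧ eqF l l'
edge C (xV i l)      (yV i' l')   = eqF i i' ∧ eqF l l'
edge C (cV i l)      (gV i' l')   = eqF i i' ∧ eqF l l'
edge C (gV i l)      (hV i' l')   = eqF i i' ∧ eqF l l'
edge C (cV i l)      (pV i' l')   = eqF i i' ∧ eqF l l'
edge C (pV i l)      (qV i' l')   = eqF i i' ∧ eqF l l'
edge C _             _            = false

allVx : (k n : ℕ) (Tj : Fin k → ℕ) (Mi : Fin n → ℕ) → List (Vx k n Tj Mi)
allVx k n Tj Mi =
  concatMap (λ j → uV j ∷ vV j ∷ r1 j ∷ r2 j ∷
                     (map (dV j) (allFin (Tj j)) ++
                      concatMap (λ x → fV j x ∷ map (fpend j x) (allFin 2))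
                                (allFin ⌈ Tj j /2⌉)))
            (allFin k)
  ++
  concatMap (λ i → aV i ∷
                     concatMap (λ l → bV i l ∷ cV i l ∷ wV i l ∷ xV i l ∷ yV i l ∷
                                       gV i l ∷ hV i l ∷ pV i l ∷ qV i l ∷
                                       map (bpend i l) (allFin 4))
                               (allFin (Mi i)))
            (allFin n)

buildG : (k n : ℕ) (S : Fin n → Fin k → ℕ) (t : Fin k → ℕ) →
         ((i : Fin n) → Fin k → Subset (Mof S i)) → Graph
buildG k n S t C = record
  { V    = Vx k n (Tof S t) (Mof S)
  ; allV = allVx k n (Tof S t) (Mof S)
  ; adj  = λ x y → edge C x y ∨ edge C y x
  }

kPrime : (k n m : ℕ) (S : Fin n → Fin k → ℕ) (t : Fin k → ℕ) → ℤ
kPrime k n m S t =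
  (+ sumFin n (λ i → 3 ℕ.* Mof S i ℕ.+ 1)) ℤ.- (+ sumFin k (Tof S t))
    ℤ.+ (+ (2 ℕ.* k ℕ.+ m))

-- The labelling is the one of the paper: 2 on u_j, v_j, F_j, b_i^l, g_i^l, p_i^l; −1 on D_j and
-- on every pendant; and (2,2,−1,1,1) on (a_i, c_i^l, w_i^l, x_i^l, y_i^l) if s_i ∈ S', (1,1,1,−1,2)
-- otherwise. A vertex has negative neighbours only inside its own gadget (that of a dimension j,
-- or that of a pair (i,l) together with a_i), so every other gadget contributes ≥ 0 to its closed
-- neighbourhood sum, and its own gadget is evaluated exactly. The only global check is at u_j:
-- it receives −1 − T_j from r_j^1 and D_j, and 2 or 1 from each of the s_i(j) vertices c_i^l joined
-- to it, in total Σ_i s_i(j) + Σ_{s_i ∈ S'} s_i(j) ≥ T_j. A dimension gadget weighs 2 − T_j and an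
-- element gadget 3M_i + 1, plus 1 if s_i ∈ S', whence the weight is at most k'.

module Submission where

open import Defs
open import Data.Nat as ℕ using (ℕ; zero; suc; z≤n; s≤s; ⌈_/2⌉)
import Data.Nat.Properties as ℕP
open import Algebra.Properties.CommutativeSemigroup ℕP.+-commutativeSemigroup
  using () renaming (interchange to +-interchange)
open import Data.Integer as ℤ using (ℤ; +_; -_; _+_; _≤_; +≤+; -[1+_])
import Data.Integer.Properties as ℤP
open import Algebra.Properties.CommutativeSemigroup ℤP.+-commutativeSemigroup
  using () renaming (interchange to ℤ-interchange)
open import Data.Fin using (Fin; zero; suc; toℕ)
import Data.Fin.Properties as FP
open import Data.Fin.Subset using (Subset; ∣_∣)
open import Data.Vec using (lookup; []; _∷_)
open import Data.Bool using (Bool; true; false; _∧_; _∨_; T; if_then_else_)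
open import Data.Bool.Properties using (∨-identityʳ; ∧-zeroʳ; T-≡)
open import Function.Bundles using (Equivalence)
open import Data.Empty using (⊥-elim)
open import Relation.Nullary.Decidable using (True; toWitness)
import Data.List
open import Data.List using (List; []; _∷_; _++_; map; concatMap; allFin; filterᵇ; tabulate)
open import Data.Product using (Σ; ∃; _×_; _,_)
open import Function using (_∘_; id)
open import Relation.Binary.PropositionalEquality
open import Data.Integer.Tactic.RingSolver using (solve)
open import Algebra.Properties.CommutativeMonoid.Sum ℤP.+-0-commutativeMonoid
  using (sum-syntax; sum-cong-≗; ∑-distrib-+; sum-replicate-zero)

sumℤ-++ : ∀ {A : Set} (g : A → ℤ) xs ys →
          sumℤ (map g (xs ++ ys)) ≡ sumℤ (map g xs) + sumℤ (map g ys)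
sumℤ-++ g []       ys = sym (ℤP.+-identityˡ _)
sumℤ-++ g (x ∷ xs) ys = trans (cong (_+_ (g x)) (sumℤ-++ g xs ys)) (sym (ℤP.+-assoc (g x) _ _))

sumℤ-concatMap : ∀ {A B : Set} (g : B → ℤ) (h : A → List B) xs →
                 sumℤ (map g (concatMap h xs)) ≡ sumℤ (map (sumℤ ∘ map g ∘ h) xs)
sumℤ-concatMap g h []       = refl
sumℤ-concatMap g h (x ∷ xs) =
  trans (sumℤ-++ g (h x) (concatMap h xs)) (cong (_+_ (sumℤ (map g (h x)))) (sumℤ-concatMap g h xs))

sumℤ-map-∘ : ∀ {A B : Set} (g : B → ℤ) (h : A → B) xs → sumℤ (map g (map h xs)) ≡ sumℤ (map (g ∘ h) xs)
sumℤ-map-∘ g h []       = refl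
sumℤ-map-∘ g h (x ∷ xs) = cong (_+_ (g (h x))) (sumℤ-map-∘ g h xs)

sumℤ-tabulate : ∀ {A : Set} n (g : A → ℤ) (h : Fin n → A) → sumℤ (map g (tabulate h)) ≡ ∑[ i < n ] g (h i)
sumℤ-tabulate zero    g h = refl
sumℤ-tabulate (suc n) g h = cong (_+_ (g (h zero))) (sumℤ-tabulate n g (h ∘ suc))

sumℤ-allFin : ∀ n (g : Fin n → ℤ) → sumℤ (map g (allFin n)) ≡ ∑[ i < n ] g i
sumℤ-allFin n g = sumℤ-tabulate n g id

sumℤ-filterᵇ : ∀ {A : Set} (p : A → Bool) (g : A → ℤ) xs →
               sumℤ (map g (filterᵇ p xs)) ≡ sumℤ (map (λ x → if p x then g x else + 0) xs)
sumℤ-filterᵇ p g []       = refl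
sumℤ-filterᵇ p g (x ∷ xs) with p x
... | true  = cong (_+_ (g x)) (sumℤ-filterᵇ p g xs)
... | false = trans (sumℤ-filterᵇ p g xs) (sym (ℤP.+-identityˡ _))

∑-mono-≤ : ∀ n {g h : Fin n → ℤ} → (∀ i → g i ≤ h i) → ∑[ i < n ] g i ≤ ∑[ i < n ] h i
∑-mono-≤ zero    g≤h = ℤP.≤-refl
∑-mono-≤ (suc n) g≤h = ℤP.+-mono-≤ (g≤h zero) (∑-mono-≤ n (g≤h ∘ suc))

∑-nonneg : ∀ n {g : Fin n → ℤ} → (∀ i → + 0 ≤ g i) → + 0 ≤ ∑[ i < n ] g i
∑-nonneg n {g} 0≤g = subst (_≤ ∑[ i < n ] g i) (sum-replicate-zero n) (∑-mono-≤ n 0≤g)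

≤-addʳ : ∀ {a b c} → a ≤ b → + 0 ≤ c → a ≤ b + c
≤-addʳ {a} a≤b 0≤c = subst (_≤ _) (ℤP.+-identityʳ a) (ℤP.+-mono-≤ a≤b 0≤c)

≤-addˡ : ∀ {a b c} → + 0 ≤ c → a ≤ b → a ≤ c + b
≤-addˡ {a} 0≤c a≤b = subst (_≤ _) (ℤP.+-identityˡ a) (ℤP.+-mono-≤ 0≤c a≤b)

∑-≥-single : ∀ n {g : Fin n → ℤ} (i : Fin n) → (∀ j → j ≢ i → + 0 ≤ g j) → g i ≤ ∑[ j < n ] g j
∑-≥-single (suc n) zero    0≤g = ≤-addʳ ℤP.≤-refl (∑-nonneg n (λ j → 0≤g (suc j) λ ()))
∑-≥-single (suc n) (suc i) 0≤g =
  ≤-addˡ (0≤g zero λ ()) (∑-≥-single n i (λ j j≢i → 0≤g (suc j) (j≢i ∘ FP.suc-injective)))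

∑-pos : ∀ n (g : Fin n → ℕ) → ∑[ i < n ] (+ g i) ≡ + sumFin n g
∑-pos zero    g = refl
∑-pos (suc n) g = trans (cong (_+_ (+ g zero)) (∑-pos n (g ∘ suc))) (sym (ℤP.pos-+ (g zero) _))

∑-neg : ∀ n (g : Fin n → ℤ) → ∑[ i < n ] (- g i) ≡ - (∑[ i < n ] g i)
∑-neg zero    g = refl
∑-neg (suc n) g = trans (cong (_+_ (- g zero)) (∑-neg n (g ∘ suc))) (sym (ℤP.neg-distrib-+ (g zero) _))

∑-subset : ∀ m (P : Subset m) c → ∑[ l < m ] (if lookup P l then + c else + 0) ≡ + (∣ P ∣ ℕ.* c)
∑-subset zero    []          c = refl
∑-subset (suc m) (true ∷ P)  c = trans (cong (_+_ (+ c)) (∑-subset m P c)) (sym (ℤP.pos-+ c _))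
∑-subset (suc m) (false ∷ P) c = trans (ℤP.+-identityˡ _) (∑-subset m P c)

sumFin-cong : ∀ n {g h : Fin n → ℕ} → (∀ i → g i ≡ h i) → sumFin n g ≡ sumFin n h
sumFin-cong zero    g≡h = refl
sumFin-cong (suc n) g≡h = cong₂ ℕ._+_ (g≡h zero) (sumFin-cong n (g≡h ∘ suc))

sumFin-+ : ∀ n (g h : Fin n → ℕ) → sumFin n (λ i → g i ℕ.+ h i) ≡ sumFin n g ℕ.+ sumFin n h
sumFin-+ zero    g h = refl
sumFin-+ (suc n) g h = trans (cong (g zero ℕ.+ h zero ℕ.+_) (sumFin-+ n (g ∘ suc) (h ∘ suc)))
                             (+-interchange (g zero) (h zero) _ _)

sumFin-const : ∀ n c → sumFin n (λ _ → c) ≡ n ℕ.* c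
sumFin-const zero    c = refl
sumFin-const (suc n) c = cong (c ℕ.+_) (sumFin-const n c)

sumFin-count : ∀ n (P : Subset n) → sumFin n (λ i → if lookup P i then 1 else 0) ≡ ∣ P ∣
sumFin-count zero    []          = refl
sumFin-count (suc n) (true ∷ P)  = cong suc (sumFin-count n P)
sumFin-count (suc n) (false ∷ P) = sumFin-count n P

∑-const : ∀ n c → ∑[ i < n ] (+ c) ≡ + (n ℕ.* c)
∑-const n c = trans (∑-pos n (λ _ → c)) (cong +_ (sumFin-const n c))

∑-minus-one : ∀ n → ∑[ i < n ] -[1+ 0 ] ≡ - (+ n)
∑-minus-one n = trans (∑-neg n (λ _ → + 1)) (cong -_ (trans (∑-const n 1) (cong +_ (ℕP.*-identityʳ n))))

module Gadgets {k n : ℕ} {Tj : Fin k → ℕ} {Mi : Fin n → ℕ} where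

  fStar : (j : Fin k) → Fin ⌈ Tj j /2⌉ → List (Vx k n Tj Mi)
  fStar j x = fV j x ∷ map (fpend j x) (allFin 2)

  jGadget : Fin k → List (Vx k n Tj Mi)
  jGadget j = uV j ∷ vV j ∷ r1 j ∷ r2 j ∷
              (map (dV j) (allFin (Tj j)) ++ concatMap (fStar j) (allFin ⌈ Tj j /2⌉))

  lGadget : (i : Fin n) → Fin (Mi i) → List (Vx k n Tj Mi)
  lGadget i l = bV i l ∷ cV i l ∷ wV i l ∷ xV i l ∷ yV i l ∷ gV i l ∷ hV i l ∷ pV i l ∷ qV i l ∷
                map (bpend i l) (allFin 4)

  iGadget : Fin n → List (Vx k n Tj Mi)
  iGadget i = aV i ∷ concatMap (lGadget i) (allFin (Mi i))

open Gadgets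

module Blocks {k n : ℕ} {Tj : Fin k → ℕ} {Mi : Fin n → ℕ} (g : Vx k n Tj Mi → ℤ) where

  fBlock : (j : Fin k) → Fin ⌈ Tj j /2⌉ → ℤ
  fBlock j x = sumℤ (map g (fStar j x))

  jBlock : Fin k → ℤ
  jBlock j = g (uV j) + (g (vV j) + (g (r1 j) + (g (r2 j) +
             (∑[ x < Tj j ] g (dV j x) + ∑[ x < ⌈ Tj j /2⌉ ] fBlock j x))))

  lBlock : (i : Fin n) → Fin (Mi i) → ℤ
  lBlock i l = sumℤ (map g (lGadget i l))

  iBlock : Fin n → ℤ
  iBlock i = g (aV i) + ∑[ l < Mi i ] lBlock i l

  sumℤ-jGadget : ∀ j → sumℤ (map g (jGadget j)) ≡ jBlock j
  sumℤ-jGadget j = cong (λ z → g (uV j) + (g (vV j) + (g (r1 j) + (g (r2 j) + z)))) (begin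
      sumℤ (map g (map (dV j) (allFin (Tj j)) ++ concatMap (fStar j) (allFin ⌈ Tj j /2⌉)))
    ≡⟨ sumℤ-++ g (map (dV j) (allFin (Tj j))) _ ⟩
      sumℤ (map g (map (dV j) (allFin (Tj j)))) + sumℤ (map g (concatMap (fStar j) (allFin ⌈ Tj j /2⌉)))
    ≡⟨ cong₂ _+_ (trans (sumℤ-map-∘ g (dV j) (allFin (Tj j))) (sumℤ-allFin _ (g ∘ dV j)))
                 (trans (sumℤ-concatMap g (fStar j) (allFin ⌈ Tj j /2⌉)) (sumℤ-allFin _ (fBlock j))) ⟩
      ∑[ x < Tj j ] g (dV j x) + ∑[ x < ⌈ Tj j /2⌉ ] fBlock j x
    ∎)
    where open ≡-Reasoning

  sumℤ-iGadget : ∀ i → sumℤ (map g (iGadget i)) ≡ iBlock i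
  sumℤ-iGadget i = cong (_+_ (g (aV i)))
    (trans (sumℤ-concatMap g (lGadget i) (allFin (Mi i))) (sumℤ-allFin (Mi i) (lBlock i)))

  sumℤ-allVx : sumℤ (map g (allVx k n Tj Mi)) ≡ ∑[ j < k ] jBlock j + ∑[ i < n ] iBlock i
  sumℤ-allVx = begin
      sumℤ (map g (concatMap jGadget (allFin k) ++ concatMap iGadget (allFin n)))
    ≡⟨ sumℤ-++ g (concatMap jGadget (allFin k)) _ ⟩
      sumℤ (map g (concatMap jGadget (allFin k))) + sumℤ (map g (concatMap iGadget (allFin n)))
    ≡⟨ cong₂ _+_ (trans (sumℤ-concatMap g jGadget (allFin k)) (trans (sumℤ-allFin k _) (sum-cong-≗ sumℤ-jGadget)))
                 (trans (sumℤ-concatMap g iGadget (allFin n)) (trans (sumℤ-allFin n _) (sum-cong-≗ sumℤ-iGadget))) ⟩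
      ∑[ j < k ] jBlock j + ∑[ i < n ] iBlock i
    ∎
    where open ≡-Reasoning

open Blocks

≡true⇒T : ∀ {b} → b ≡ true → T b
≡true⇒T = Equivalence.from T-≡

≡ᵇ-refl : ∀ m → (m ℕ.≡ᵇ m) ≡ true
≡ᵇ-refl zero    = refl
≡ᵇ-refl (suc m) = ≡ᵇ-refl m

≡ᵇ-sym : ∀ m n → (m ℕ.≡ᵇ n) ≡ (n ℕ.≡ᵇ m)
≡ᵇ-sym zero    zero    = refl
≡ᵇ-sym zero    (suc n) = refl
≡ᵇ-sym (suc m) zero    = refl
≡ᵇ-sym (suc m) (suc n) = ≡ᵇ-sym m n

eqF-refl : ∀ {a} (i : Fin a) → eqF i i ≡ true
eqF-refl i = ≡ᵇ-refl (toℕ i)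

eqF-sym : ∀ {a b} (i : Fin a) (j : Fin b) → eqF i j ≡ eqF j i
eqF-sym i j = ≡ᵇ-sym (toℕ i) (toℕ j)

eqF-≢ : ∀ {a} {i j : Fin a} → i ≢ j → eqF i j ≡ false
eqF-≢ {i = i} {j} i≢j with eqF i j in eq
... | true  = ⊥-elim (i≢j (FP.toℕ-injective (ℕP.≡ᵇ⇒≡ (toℕ i) (toℕ j) (≡true⇒T eq))))
... | false = refl

eqF-flip : ∀ {a} (j j' : Fin a) → eqF j' j ≡ false → eqF j j' ∨ false ≡ false
eqF-flip j j' off = trans (∨-identityʳ _) (trans (eqF-sym j j') off)

eqF²-flip : ∀ {a b b'} (i i' : Fin a) (l : Fin b) (l' : Fin b') →
            eqF i' i ∧ eqF l' l ≡ false → (eqF i i' ∧ eqF l l') ∨ false ≡ false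
eqF²-flip i i' l l' off =
  trans (∨-identityʳ _) (trans (cong₂ _∧_ (eqF-sym i i') (eqF-sym l l')) off)

≤-decide : ∀ {a b : ℤ} {a≤b : True (a ℤ.≤? b)} → a ≤ b
≤-decide {a≤b = a≤b} = toWitness a≤b

0≤0 : + 0 ≤ + 0
0≤0 = ℤP.≤-refl

0≤+ : ∀ {m} → + 0 ≤ + m
0≤+ = +≤+ z≤n

0≤val-if : ∀ b {x y} → + 0 ≤ val x → + 0 ≤ val y → + 0 ≤ val (if b then x else y)
0≤val-if true  0≤x 0≤y = 0≤x
0≤val-if false 0≤x 0≤y = 0≤y

1≤2-1-m+n : ∀ m n → m ℕ.≤ n → + 1 ≤ + 2 + ((-[1+ 0 ] + - (+ m)) + + n)
1≤2-1-m+n m n m≤n rewrite ℤP.+-assoc -[1+ 0 ] (- (+ m)) (+ n) | ℤP.-m+n≡n⊖m m n | ℤP.≤-⊖ m≤n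
  with n ℕ.∸ m
... | zero  = ℤP.≤-refl
... | suc d = +≤+ (s≤s z≤n)

n≤⌈n/2⌉*2 : ∀ n → n ℕ.≤ ⌈ n /2⌉ ℕ.* 2
n≤⌈n/2⌉*2 zero          = z≤n
n≤⌈n/2⌉*2 (suc zero)    = s≤s z≤n
n≤⌈n/2⌉*2 (suc (suc n)) = s≤s (s≤s (n≤⌈n/2⌉*2 n))

module Labelling {k n : ℕ} (S : Fin n → Fin k → ℕ) (t : Fin k → ℕ)
                 (C : (i : Fin n) → Fin k → Subset (Mof S i)) (I : Subset n) where

  G : Graph
  G = buildG k n S t C

  f : V G → Label
  f (uV j)        = two
  f (vV j)        = two
  f (r1 j)        = neg
  f (r2 j)        = neg
  f (dV j x)      = neg
  f (fV j x)      = two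
  f (fpend j x e) = neg
  f (aV i)        = if lookup I i then two else one
  f (bV i l)      = two
  f (cV i l)      = if lookup I i then two else one
  f (wV i l)      = if lookup I i then neg else one
  f (xV i l)      = if lookup I i then one else neg
  f (yV i l)      = if lookup I i then one else two
  f (gV i l)      = two
  f (hV i l)      = neg
  f (pV i l)      = two
  f (qV i l)      = neg
  f (bpend i l e) = neg

  -- When u and w are constructor applications that are not adjacent, nb u w computes to + 0;
  -- this is what the many 0≤0 arguments below rely on.
  nb : V G → V G → ℤ
  nb u w = if adj G u w then val (f w) else + 0

  closedSum-blocks : ∀ u → closedSum G f u ≡
                     val (f u) + (∑[ j < k ] jBlock (nb u) j + ∑[ i < n ] iBlock (nb u) i)
  closedSum-blocks u =
    cong (_+_ (val (f u))) (trans (sumℤ-filterᵇ (adj G u) (val ∘ f) (allV G)) (sumℤ-allVx (nb u)))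

  nb-nonneg : ∀ u w → + 0 ≤ val (f w) → + 0 ≤ nb u w
  nb-nonneg u w 0≤fw with adj G u w
  ... | true  = 0≤fw
  ... | false = 0≤0

  nb-apart : ∀ u w → adj G u w ≡ false → + 0 ≤ nb u w
  nb-apart u w apart rewrite apart = 0≤0

  0≤nb-aV : ∀ u i → + 0 ≤ nb u (aV i)
  0≤nb-aV u i = nb-nonneg u (aV i) (0≤val-if (lookup I i) 0≤+ 0≤+)

  fBlock-nonneg : ∀ u j x → (∀ e → + 0 ≤ nb u (fpend j x e)) → + 0 ≤ fBlock (nb u) j x
  fBlock-nonneg u j x 0≤fp =
    ℤP.+-mono-≤ (nb-nonneg u (fV j x) 0≤+) (ℤP.+-mono-≤ (0≤fp zero) (ℤP.+-mono-≤ (0≤fp (suc zero)) 0≤0))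

  jBlock-≥ : ∀ u j {s} → + 0 ≤ nb u (r1 j) → + 0 ≤ nb u (r2 j) → (∀ x → + 0 ≤ nb u (dV j x)) →
             s ≤ ∑[ x < ⌈ Tof S t j /2⌉ ] fBlock (nb u) j x → nb u (uV j) + (nb u (vV j) + s) ≤ jBlock (nb u) j
  jBlock-≥ u j 0≤r₁ 0≤r₂ 0≤d s≤F =
    ℤP.+-monoʳ-≤ (nb u (uV j)) (ℤP.+-monoʳ-≤ (nb u (vV j))
      (≤-addˡ 0≤r₁ (≤-addˡ 0≤r₂ (≤-addˡ (∑-nonneg (Tof S t j) 0≤d) s≤F))))

  jBlock-≥-hubs : ∀ u j → + 0 ≤ nb u (r1 j) → + 0 ≤ nb u (r2 j) → (∀ x → + 0 ≤ nb u (dV j x)) →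
                  (∀ x e → + 0 ≤ nb u (fpend j x e)) → nb u (uV j) + (nb u (vV j) + + 0) ≤ jBlock (nb u) j
  jBlock-≥-hubs u j 0≤r₁ 0≤r₂ 0≤d 0≤fp =
    jBlock-≥ u j 0≤r₁ 0≤r₂ 0≤d (∑-nonneg _ (λ x → fBlock-nonneg u j x (0≤fp x)))

  jBlock-≥-star : ∀ u j x → + 0 ≤ nb u (r1 j) → + 0 ≤ nb u (r2 j) → (∀ x → + 0 ≤ nb u (dV j x)) →
                  (∀ x' → eqF x' x ≡ false → ∀ e → + 0 ≤ nb u (fpend j x' e)) →
                  nb u (uV j) + (nb u (vV j) + fBlock (nb u) j x) ≤ jBlock (nb u) j
  jBlock-≥-star u j x 0≤r₁ 0≤r₂ 0≤d 0≤fp = jBlock-≥ u j 0≤r₁ 0≤r₂ 0≤d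
    (∑-≥-single _ x (λ x' x'≢x → fBlock-nonneg u j x' (0≤fp x' (eqF-≢ x'≢x))))

  jBlock-nonneg : ∀ u j → + 0 ≤ nb u (r1 j) → + 0 ≤ nb u (r2 j) → (∀ x → + 0 ≤ nb u (dV j x)) →
                  (∀ x e → + 0 ≤ nb u (fpend j x e)) → + 0 ≤ jBlock (nb u) j
  jBlock-nonneg u j 0≤r₁ 0≤r₂ 0≤d 0≤fp = ℤP.≤-trans
    (ℤP.+-mono-≤ (nb-nonneg u (uV j) 0≤+) (ℤP.+-mono-≤ (nb-nonneg u (vV j) 0≤+) 0≤0))
    (jBlock-≥-hubs u j 0≤r₁ 0≤r₂ 0≤d 0≤fp)

  lBlock-nonneg : ∀ u i l → + 0 ≤ nb u (wV i l) → + 0 ≤ nb u (xV i l) → + 0 ≤ nb u (hV i l) →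
                  + 0 ≤ nb u (qV i l) → (∀ e → + 0 ≤ nb u (bpend i l e)) → + 0 ≤ lBlock (nb u) i l
  lBlock-nonneg u i l 0≤w 0≤x 0≤h 0≤q 0≤bp =
    nb-nonneg u (bV i l) 0≤+ ⊕ nb-nonneg u (cV i l) (0≤val-if (lookup I i) 0≤+ 0≤+) ⊕ 0≤w ⊕ 0≤x ⊕
    nb-nonneg u (yV i l) (0≤val-if (lookup I i) 0≤+ 0≤+) ⊕ nb-nonneg u (gV i l) 0≤+ ⊕ 0≤h ⊕
    nb-nonneg u (pV i l) 0≤+ ⊕ 0≤q ⊕ 0≤bp zero ⊕ 0≤bp (suc zero) ⊕ 0≤bp (suc (suc zero)) ⊕
    0≤bp (suc (suc (suc zero))) ⊕ 0≤0
    where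
    infixr 5 _⊕_
    _⊕_ : ∀ {a b} → + 0 ≤ a → + 0 ≤ b → + 0 ≤ a + b
    _⊕_ = ℤP.+-mono-≤

  iBlock-nonneg : ∀ u i → (∀ l → + 0 ≤ lBlock (nb u) i l) → + 0 ≤ iBlock (nb u) i
  iBlock-nonneg u i 0≤L = ℤP.+-mono-≤ (0≤nb-aV u i) (∑-nonneg _ 0≤L)

  jPart-≥-own : ∀ u j → (∀ j' → eqF j' j ≡ false → + 0 ≤ jBlock (nb u) j') →
                jBlock (nb u) j ≤ ∑[ j' < k ] jBlock (nb u) j'
  jPart-≥-own u j 0≤off = ∑-≥-single k j (λ j' j'≢j → 0≤off j' (eqF-≢ j'≢j))

  iPart-≥-own : ∀ u i l → (∀ i' l' → eqF i' i ∧ eqF l' l ≡ false → + 0 ≤ lBlock (nb u) i' l') →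
                nb u (aV i) + lBlock (nb u) i l ≤ ∑[ i' < n ] iBlock (nb u) i'
  iPart-≥-own u i l 0≤off = ℤP.≤-trans
    (ℤP.+-monoʳ-≤ (nb u (aV i))
      (∑-≥-single (Mof S i) l (λ l' l'≢l → 0≤off i l' (cong₂ _∧_ (eqF-refl i) (eqF-≢ l'≢l)))))
    (∑-≥-single n i (λ i' i'≢i →
      iBlock-nonneg u i' (λ l' → 0≤off i' l' (cong (_∧ eqF l' l) (eqF-≢ i'≢i)))))

  dominated-by : ∀ u {a b} → + 1 ≤ val (f u) + (a + b) →
                 a ≤ ∑[ j < k ] jBlock (nb u) j → b ≤ ∑[ i < n ] iBlock (nb u) i → + 1 ≤ closedSum G f u
  dominated-by u 1≤fu+a+b a≤J b≤I = subst (+ 1 ≤_) (sym (closedSum-blocks u))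
    (ℤP.≤-trans 1≤fu+a+b (ℤP.+-monoʳ-≤ (val (f u)) (ℤP.+-mono-≤ a≤J b≤I)))

  dominated-at-lGadget : ∀ u i l → + 1 ≤ val (f u) + (nb u (aV i) + lBlock (nb u) i l) →
                         (∀ j → + 0 ≤ jBlock (nb u) j) →
                         (∀ i' l' → eqF i' i ∧ eqF l' l ≡ false → + 0 ≤ lBlock (nb u) i' l') →
                         + 1 ≤ closedSum G f u
  dominated-at-lGadget u i l own 0≤J 0≤off =
    dominated-by u (subst (λ z → + 1 ≤ val (f u) + z) (sym (ℤP.+-identityˡ _)) own)
      (∑-nonneg k 0≤J) (iPart-≥-own u i l 0≤off)

  dominated-at-jGadget : ∀ u j {a} → + 1 ≤ val (f u) + a → a ≤ jBlock (nb u) j →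
                         (∀ j' → eqF j' j ≡ false → + 0 ≤ jBlock (nb u) j') →
                         (∀ i → + 0 ≤ iBlock (nb u) i) → + 1 ≤ closedSum G f u
  dominated-at-jGadget u j {a} own a≤J 0≤off 0≤I =
    dominated-by u (subst (λ z → + 1 ≤ val (f u) + z) (sym (ℤP.+-identityʳ a)) own)
      (ℤP.≤-trans a≤J (jPart-≥-own u j 0≤off)) (∑-nonneg n 0≤I)

  aV-dominated : ∀ i → + 1 ≤ closedSum G f (aV i)
  aV-dominated i = dominated-by u own (∑-nonneg k (λ j → jBlock-nonneg u j 0≤0 0≤0 (λ _ → 0≤0) (λ _ _ → 0≤0)))
    (∑-nonneg n (λ i → iBlock-nonneg u i λ l → lBlock-nonneg u i l 0≤0 0≤0 0≤0 0≤0 (λ _ → 0≤0)))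
    where
    u = aV i
    own : + 1 ≤ val (f u) + (+ 0 + + 0)
    own with lookup I i
    ... | true  = ≤-decide
    ... | false = ≤-decide

  bV-dominated : ∀ i l → + 1 ≤ closedSum G f (bV i l)
  bV-dominated i l = dominated-at-lGadget u i l own
    (λ j → jBlock-nonneg u j 0≤0 0≤0 (λ _ → 0≤0) (λ _ _ → 0≤0))
    (λ i' l' off → lBlock-nonneg u i' l' (nb-apart u (wV i' l') off) 0≤0 0≤0 0≤0 (λ e → nb-apart u (bpend i' l' e) off))
    where
    u = bV i l
    own : + 1 ≤ val (f u) + (nb u (aV i) + lBlock (nb u) i l)
    own rewrite eqF-refl i | eqF-refl l with lookup I i
    ... | true  = ≤-decide
    ... | false = ≤-decide

  cV-dominated : ∀ i l → + 1 ≤ closedSum G f (cV i l)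
  cV-dominated i l = dominated-at-lGadget u i l own
    (λ j → jBlock-nonneg u j 0≤0 0≤0 (λ _ → 0≤0) (λ _ _ → 0≤0))
    (λ i' l' _ → lBlock-nonneg u i' l' 0≤0 0≤0 0≤0 0≤0 (λ _ → 0≤0))
    where
    u = cV i l
    own : + 1 ≤ val (f u) + (nb u (aV i) + lBlock (nb u) i l)
    own rewrite eqF-refl i | eqF-refl l with lookup I i
    ... | true  = ≤-decide
    ... | false = ≤-decide

  wV-dominated : ∀ i l → + 1 ≤ closedSum G f (wV i l)
  wV-dominated i l = dominated-at-lGadget u i l own
    (λ j → jBlock-nonneg u j 0≤0 0≤0 (λ _ → 0≤0) (λ _ _ → 0≤0))
    (λ i' l' off → lBlock-nonneg u i' l' 0≤0 (nb-apart u (xV i' l') (eqF²-flip i i' l l' off)) 0≤0 0≤0 (λ _ → 0≤0))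
    where
    u = wV i l
    own : + 1 ≤ val (f u) + (nb u (aV i) + lBlock (nb u) i l)
    own rewrite eqF-refl i | eqF-refl l with lookup I i
    ... | true  = ≤-decide
    ... | false = ≤-decide

  xV-dominated : ∀ i l → + 1 ≤ closedSum G f (xV i l)
  xV-dominated i l = dominated-at-lGadget u i l own
    (λ j → jBlock-nonneg u j 0≤0 0≤0 (λ _ → 0≤0) (λ _ _ → 0≤0))
    (λ i' l' off → lBlock-nonneg u i' l' (nb-apart u (wV i' l') off) 0≤0 0≤0 0≤0 (λ _ → 0≤0))
    where
    u = xV i l
    own : + 1 ≤ val (f u) + (nb u (aV i) + lBlock (nb u) i l)
    own rewrite eqF-refl i | eqF-refl l with lookup I i
    ... | true  = ≤-decide
    ... | false = ≤-decide

  yV-dominated : ∀ i l → + 1 ≤ closedSum G f (yV i l)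
  yV-dominated i l = dominated-at-lGadget u i l own
    (λ j → jBlock-nonneg u j 0≤0 0≤0 (λ _ → 0≤0) (λ _ _ → 0≤0))
    (λ i' l' off → lBlock-nonneg u i' l' 0≤0 (nb-apart u (xV i' l') off) 0≤0 0≤0 (λ _ → 0≤0))
    where
    u = yV i l
    own : + 1 ≤ val (f u) + (nb u (aV i) + lBlock (nb u) i l)
    own rewrite eqF-refl i | eqF-refl l with lookup I i
    ... | true  = ≤-decide
    ... | false = ≤-decide

  gV-dominated : ∀ i l → + 1 ≤ closedSum G f (gV i l)
  gV-dominated i l = dominated-at-lGadget u i l own
    (λ j → jBlock-nonneg u j 0≤0 0≤0 (λ _ → 0≤0) (λ _ _ → 0≤0))
    (λ i' l' off → lBlock-nonneg u i' l' 0≤0 0≤0 (nb-apart u (hV i' l') (eqF²-flip i i' l l' off)) 0≤0 (λ _ → 0≤0))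
    where
    u = gV i l
    own : + 1 ≤ val (f u) + (nb u (aV i) + lBlock (nb u) i l)
    own rewrite eqF-refl i | eqF-refl l with lookup I i
    ... | true  = ≤-decide
    ... | false = ≤-decide

  hV-dominated : ∀ i l → + 1 ≤ closedSum G f (hV i l)
  hV-dominated i l = dominated-at-lGadget u i l own
    (λ j → jBlock-nonneg u j 0≤0 0≤0 (λ _ → 0≤0) (λ _ _ → 0≤0))
    (λ i' l' _ → lBlock-nonneg u i' l' 0≤0 0≤0 0≤0 0≤0 (λ _ → 0≤0))
    where
    u = hV i l
    own : + 1 ≤ val (f u) + (nb u (aV i) + lBlock (nb u) i l)
    own rewrite eqF-refl i | eqF-refl l = ≤-decide

  pV-dominated : ∀ i l → + 1 ≤ closedSum G f (pV i l)
  pV-dominated i l = dominated-at-lGadget u i l own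
    (λ j → jBlock-nonneg u j 0≤0 0≤0 (λ _ → 0≤0) (λ _ _ → 0≤0))
    (λ i' l' off → lBlock-nonneg u i' l' 0≤0 0≤0 0≤0 (nb-apart u (qV i' l') (eqF²-flip i i' l l' off)) (λ _ → 0≤0))
    where
    u = pV i l
    own : + 1 ≤ val (f u) + (nb u (aV i) + lBlock (nb u) i l)
    own rewrite eqF-refl i | eqF-refl l with lookup I i
    ... | true  = ≤-decide
    ... | false = ≤-decide

  qV-dominated : ∀ i l → + 1 ≤ closedSum G f (qV i l)
  qV-dominated i l = dominated-at-lGadget u i l own
    (λ j → jBlock-nonneg u j 0≤0 0≤0 (λ _ → 0≤0) (λ _ _ → 0≤0))
    (λ i' l' _ → lBlock-nonneg u i' l' 0≤0 0≤0 0≤0 0≤0 (λ _ → 0≤0))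
    where
    u = qV i l
    own : + 1 ≤ val (f u) + (nb u (aV i) + lBlock (nb u) i l)
    own rewrite eqF-refl i | eqF-refl l = ≤-decide

  bpend-dominated : ∀ i l e → + 1 ≤ closedSum G f (bpend i l e)
  bpend-dominated i l e = dominated-at-lGadget u i l own
    (λ j → jBlock-nonneg u j 0≤0 0≤0 (λ _ → 0≤0) (λ _ _ → 0≤0))
    (λ i' l' _ → lBlock-nonneg u i' l' 0≤0 0≤0 0≤0 0≤0 (λ _ → 0≤0))
    where
    u = bpend i l e
    own : + 1 ≤ val (f u) + (nb u (aV i) + lBlock (nb u) i l)
    own rewrite eqF-refl i | eqF-refl l = ≤-decide

  r1-dominated : ∀ j → + 1 ≤ closedSum G f (r1 j)
  r1-dominated j = dominated-at-jGadget u j own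
    (jBlock-≥-hubs u j 0≤0 0≤0 (λ _ → 0≤0) (λ _ _ → 0≤0))
    (λ j' _ → jBlock-nonneg u j' 0≤0 0≤0 (λ _ → 0≤0) (λ _ _ → 0≤0))
    (λ i → iBlock-nonneg u i λ l → lBlock-nonneg u i l 0≤0 0≤0 0≤0 0≤0 (λ _ → 0≤0))
    where
    u = r1 j
    own : + 1 ≤ val (f u) + (nb u (uV j) + (nb u (vV j) + + 0))
    own rewrite eqF-refl j = ≤-decide

  r2-dominated : ∀ j → + 1 ≤ closedSum G f (r2 j)
  r2-dominated j = dominated-at-jGadget u j own
    (jBlock-≥-hubs u j 0≤0 0≤0 (λ _ → 0≤0) (λ _ _ → 0≤0))
    (λ j' _ → jBlock-nonneg u j' 0≤0 0≤0 (λ _ → 0≤0) (λ _ _ → 0≤0))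
    (λ i → iBlock-nonneg u i λ l → lBlock-nonneg u i l 0≤0 0≤0 0≤0 0≤0 (λ _ → 0≤0))
    where
    u = r2 j
    own : + 1 ≤ val (f u) + (nb u (uV j) + (nb u (vV j) + + 0))
    own rewrite eqF-refl j = ≤-decide

  dV-dominated : ∀ j x → + 1 ≤ closedSum G f (dV j x)
  dV-dominated j x = dominated-at-jGadget u j own
    (jBlock-≥-hubs u j 0≤0 0≤0 (λ _ → 0≤0) (λ _ _ → 0≤0))
    (λ j' _ → jBlock-nonneg u j' 0≤0 0≤0 (λ _ → 0≤0) (λ _ _ → 0≤0))
    (λ i → iBlock-nonneg u i λ l → lBlock-nonneg u i l 0≤0 0≤0 0≤0 0≤0 (λ _ → 0≤0))
    where
    u = dV j x
    own : + 1 ≤ val (f u) + (nb u (uV j) + (nb u (vV j) + + 0))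
    own rewrite eqF-refl j = ≤-decide

  fpend-dominated : ∀ j x e → + 1 ≤ closedSum G f (fpend j x e)
  fpend-dominated j x e = dominated-at-jGadget u j own
    (jBlock-≥-star u j x 0≤0 0≤0 (λ _ → 0≤0) (λ _ _ _ → 0≤0))
    (λ j' _ → jBlock-nonneg u j' 0≤0 0≤0 (λ _ → 0≤0) (λ _ _ → 0≤0))
    (λ i → iBlock-nonneg u i λ l → lBlock-nonneg u i l 0≤0 0≤0 0≤0 0≤0 (λ _ → 0≤0))
    where
    u = fpend j x e
    own : + 1 ≤ val (f u) + (nb u (uV j) + (nb u (vV j) + fBlock (nb u) j x))
    own rewrite eqF-refl j | eqF-refl x = ≤-decide

  fV-dominated : ∀ j x → + 1 ≤ closedSum G f (fV j x)
  fV-dominated j x = dominated-at-jGadget u j own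
    (jBlock-≥-star u j x 0≤0 0≤0 (λ _ → 0≤0)
      (λ x' off e → nb-apart u (fpend j x' e) (trans (cong (eqF j j ∧_) off) (∧-zeroʳ (eqF j j)))))
    (λ j' off → jBlock-nonneg u j' 0≤0 0≤0 (λ _ → 0≤0)
      (λ x' e → nb-apart u (fpend j' x' e) (cong (_∧ eqF x' x) off)))
    (λ i → iBlock-nonneg u i λ l → lBlock-nonneg u i l 0≤0 0≤0 0≤0 0≤0 (λ _ → 0≤0))
    where
    u = fV j x
    own : + 1 ≤ val (f u) + (nb u (uV j) + (nb u (vV j) + fBlock (nb u) j x))
    own rewrite eqF-refl j | eqF-refl x = ≤-decide

  jBlock-at-vV : ∀ j → jBlock (nb (vV j)) j ≡ (-[1+ 0 ] + - (+ Tof S t j)) + + (⌈ Tof S t j /2⌉ ℕ.* 2)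
  jBlock-at-vV j rewrite eqF-refl j | ∑-minus-one (Tof S t j) | ∑-const ⌈ Tof S t j /2⌉ 2 =
    trans (ℤP.+-identityˡ _) (trans (ℤP.+-identityˡ _) (trans (ℤP.+-identityˡ _)
      (sym (ℤP.+-assoc -[1+ 0 ] (- (+ Tof S t j)) (+ (⌈ Tof S t j /2⌉ ℕ.* 2))))))

  vV-dominated : ∀ j → + 1 ≤ closedSum G f (vV j)
  vV-dominated j = dominated-at-jGadget u j own ℤP.≤-refl
    (λ j' off → jBlock-nonneg u j' 0≤0 (nb-apart u (r2 j') off)
      (λ x → nb-apart u (dV j' x) (eqF-flip j j' off)) (λ _ _ → 0≤0))
    (λ i → iBlock-nonneg u i λ l → lBlock-nonneg u i l 0≤0 0≤0 0≤0 0≤0 (λ _ → 0≤0))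
    where
    u = vV j
    own : + 1 ≤ val (f u) + jBlock (nb u) j
    own rewrite jBlock-at-vV j = 1≤2-1-m+n _ _ (n≤⌈n/2⌉*2 (Tof S t j))

  cWeight : Fin n → ℕ
  cWeight i = if lookup I i then 2 else 1

  lBlock-at-uV : ∀ j i l → lBlock (nb (uV j)) i l ≡ (if lookup (C i j) l then + cWeight i else + 0)
  lBlock-at-uV j i l rewrite ∨-identityʳ (lookup (C i j) l) with lookup (C i j) l | lookup I i
  ... | true  | true  = refl
  ... | true  | false = refl
  ... | false | _     = refl

  iPart-at-uV : (∀ i j → ∣ C i j ∣ ≡ S i j) →
                ∀ j → ∑[ i < n ] iBlock (nb (uV j)) i ≡ + sumFin n (λ i → S i j ℕ.* cWeight i)
  iPart-at-uV ∣C∣≡S j = trans (sum-cong-≗ iBlock-at-uV) (∑-pos n _)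
    where
    iBlock-at-uV : ∀ i → iBlock (nb (uV j)) i ≡ + (S i j ℕ.* cWeight i)
    iBlock-at-uV i = trans (ℤP.+-identityˡ _) (trans (sum-cong-≗ (lBlock-at-uV j i))
      (trans (∑-subset _ (C i j) (cWeight i)) (cong (λ s → + (s ℕ.* cWeight i)) (∣C∣≡S i j))))

  T≤supply : (∀ j → t j ℕ.≤ sumFin n (λ i → if lookup I i then S i j else 0)) →
             ∀ j → Tof S t j ℕ.≤ sumFin n (λ i → S i j ℕ.* cWeight i)
  T≤supply covers j = begin
      sumFin n (λ i → S i j) ℕ.+ t j
    ≤⟨ ℕP.+-monoʳ-≤ (sumFin n (λ i → S i j)) (covers j) ⟩
      sumFin n (λ i → S i j) ℕ.+ sumFin n (λ i → if lookup I i then S i j else 0)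
    ≡⟨ sym (sumFin-+ n _ _) ⟩
      sumFin n (λ i → S i j ℕ.+ (if lookup I i then S i j else 0))
    ≡⟨ sumFin-cong n (λ i → sym (S*cWeight i)) ⟩
      sumFin n (λ i → S i j ℕ.* cWeight i)
    ∎
    where
    open ℕP.≤-Reasoning
    S*cWeight : ∀ i → S i j ℕ.* cWeight i ≡ S i j ℕ.+ (if lookup I i then S i j else 0)
    S*cWeight i with lookup I i
    ... | true  = trans (ℕP.*-comm (S i j) 2) (cong (S i j ℕ.+_) (ℕP.+-identityʳ (S i j)))
    ... | false = trans (ℕP.*-identityʳ (S i j)) (sym (ℕP.+-identityʳ (S i j)))

  jBlock-at-uV : ∀ j → jBlock (nb (uV j)) j ≡ -[1+ 0 ] + - (+ Tof S t j)
  jBlock-at-uV j rewrite eqF-refl j | ∑-minus-one (Tof S t j) | sum-replicate-zero ⌈ Tof S t j /2⌉ =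
    trans (ℤP.+-identityˡ _) (trans (ℤP.+-identityˡ _)
      (cong (_+_ -[1+ 0 ]) (trans (ℤP.+-identityˡ _) (ℤP.+-identityʳ (- (+ Tof S t j))))))

  uV-dominated : (∀ i j → ∣ C i j ∣ ≡ S i j) →
                 (∀ j → t j ℕ.≤ sumFin n (λ i → if lookup I i then S i j else 0)) →
                 ∀ j → + 1 ≤ closedSum G f (uV j)
  uV-dominated ∣C∣≡S covers j = dominated-by u own
    (jPart-≥-own u j λ j' off → jBlock-nonneg u j' (nb-apart u (r1 j') off) 0≤0
      (λ x → nb-apart u (dV j' x) (eqF-flip j j' off)) (λ _ _ → 0≤0))
    (ℤP.≤-reflexive (sym (iPart-at-uV ∣C∣≡S j)))
    where
    u = uV j
    own : + 1 ≤ val (f u) + (jBlock (nb u) j + + sumFin n (λ i → S i j ℕ.* cWeight i))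
    own rewrite jBlock-at-uV j = 1≤2-1-m+n _ _ (T≤supply covers j)

  negatives-guarded : ∀ u → f u ≡ neg → ∃ λ w → T (adj G u w) × f w ≡ two
  negatives-guarded (r1 j)        _ = uV j , ≡true⇒T (cong (_∨ false) (eqF-refl j)) , refl
  negatives-guarded (r2 j)        _ = vV j , ≡true⇒T (cong (_∨ false) (eqF-refl j)) , refl
  negatives-guarded (dV j x)      _ = vV j , ≡true⇒T (eqF-refl j) , refl
  negatives-guarded (fpend j x e) _ = fV j x , ≡true⇒T (cong (_∨ false) (cong₂ _∧_ (eqF-refl j) (eqF-refl x))) , refl
  negatives-guarded (hV i l)      _ = gV i l , ≡true⇒T (cong₂ _∧_ (eqF-refl i) (eqF-refl l)) , refl
  negatives-guarded (qV i l)      _ = pV i l , ≡true⇒T (cong₂ _∧_ (eqF-refl i) (eqF-refl l)) , refl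
  negatives-guarded (bpend i l e) _ = bV i l , ≡true⇒T (cong (_∨ false) (cong₂ _∧_ (eqF-refl i) (eqF-refl l))) , refl
  negatives-guarded (wV i l) fw≡neg with lookup I i
  ... | true = bV i l , ≡true⇒T (cong (_∨ false) (cong₂ _∧_ (eqF-refl i) (eqF-refl l))) , refl
  negatives-guarded (wV i l) () | false
  negatives-guarded (xV i l) fx≡neg with lookup I i in unselected
  negatives-guarded (xV i l) () | true
  ... | false = yV i l , ≡true⇒T (cong (_∨ false) (cong₂ _∧_ (eqF-refl i) (eqF-refl l))) ,
                cong (if_then one else two) unselected
  negatives-guarded (uV j)   ()
  negatives-guarded (vV j)   ()
  negatives-guarded (fV j x) ()
  negatives-guarded (bV i l) ()
  negatives-guarded (gV i l) ()
  negatives-guarded (pV i l) ()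
  negatives-guarded (aV i)   fa≡neg with lookup I i
  negatives-guarded (aV i) () | true
  negatives-guarded (aV i) () | false
  negatives-guarded (cV i l) fc≡neg with lookup I i
  negatives-guarded (cV i l) () | true
  negatives-guarded (cV i l) () | false
  negatives-guarded (yV i l) fy≡neg with lookup I i
  negatives-guarded (yV i l) () | true
  negatives-guarded (yV i l) () | false

  dominating : (∀ i j → ∣ C i j ∣ ≡ S i j) →
               (∀ j → t j ℕ.≤ sumFin n (λ i → if lookup I i then S i j else 0)) →
               ∀ u → + 1 ≤ closedSum G f u
  dominating ∣C∣≡S covers (uV j)        = uV-dominated ∣C∣≡S covers j
  dominating ∣C∣≡S covers (vV j)        = vV-dominated j
  dominating ∣C∣≡S covers (r1 j)        = r1-dominated j
  dominating ∣C∣≡S covers (r2 j)        = r2-dominated j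
  dominating ∣C∣≡S covers (dV j x)      = dV-dominated j x
  dominating ∣C∣≡S covers (fV j x)      = fV-dominated j x
  dominating ∣C∣≡S covers (fpend j x e) = fpend-dominated j x e
  dominating ∣C∣≡S covers (aV i)        = aV-dominated i
  dominating ∣C∣≡S covers (bV i l)      = bV-dominated i l
  dominating ∣C∣≡S covers (cV i l)      = cV-dominated i l
  dominating ∣C∣≡S covers (wV i l)      = wV-dominated i l
  dominating ∣C∣≡S covers (xV i l)      = xV-dominated i l
  dominating ∣C∣≡S covers (yV i l)      = yV-dominated i l
  dominating ∣C∣≡S covers (gV i l)      = gV-dominated i l
  dominating ∣C∣≡S covers (hV i l)      = hV-dominated i l
  dominating ∣C∣≡S covers (pV i l)      = pV-dominated i l
  dominating ∣C∣≡S covers (qV i l)      = qV-dominated i l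
  dominating ∣C∣≡S covers (bpend i l e) = bpend-dominated i l e

  jBlock-weight : ∀ j → jBlock (val ∘ f) j ≡ + 2 + - (+ Tof S t j)
  jBlock-weight j rewrite ∑-minus-one (Tof S t j) | sum-replicate-zero ⌈ Tof S t j /2⌉
    with - (+ Tof S t j)
  ... | X = solve (X Data.List.∷ Data.List.[])

  lBlock-weight : ∀ i l → lBlock (val ∘ f) i l ≡ + 3
  lBlock-weight i l with lookup I i
  ... | true  = refl
  ... | false = refl

  selected : Fin n → ℕ
  selected i = if lookup I i then 1 else 0

  val-aV : ∀ i → val (f (aV i)) ≡ + (1 ℕ.+ selected i)
  val-aV i with lookup I i
  ... | true  = refl
  ... | false = refl

  iBlock-weight : ∀ i → iBlock (val ∘ f) i ≡ + (3 ℕ.* Mof S i ℕ.+ 1 ℕ.+ selected i)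
  iBlock-weight i = begin
      val (f (aV i)) + ∑[ l < M ] lBlock (val ∘ f) i l
    ≡⟨ cong₂ _+_ (val-aV i) (trans (sum-cong-≗ (lBlock-weight i)) (∑-const M 3)) ⟩
      + (1 ℕ.+ s) + + (M ℕ.* 3)
    ≡⟨ sym (ℤP.pos-+ (1 ℕ.+ s) (M ℕ.* 3)) ⟩
      + (1 ℕ.+ s ℕ.+ M ℕ.* 3)
    ≡⟨ cong +_ (trans (ℕP.+-comm (1 ℕ.+ s) (M ℕ.* 3)) (sym (ℕP.+-assoc (M ℕ.* 3) 1 s))) ⟩
      + (M ℕ.* 3 ℕ.+ 1 ℕ.+ s)
    ≡⟨ cong (λ z → + (z ℕ.+ 1 ℕ.+ s)) (ℕP.*-comm M 3) ⟩
      + (3 ℕ.* M ℕ.+ 1 ℕ.+ s)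
    ∎
    where
    open ≡-Reasoning
    M = Mof S i
    s = selected i

  weight-value : weight G f ≡ (+ sumFin n (λ i → 3 ℕ.* Mof S i ℕ.+ 1) ℤ.- + sumFin k (Tof S t)) + + (2 ℕ.* k ℕ.+ ∣ I ∣)
  weight-value = begin
      weight G f
    ≡⟨ sumℤ-allVx (val ∘ f) ⟩
      ∑[ j < k ] jBlock (val ∘ f) j + ∑[ i < n ] iBlock (val ∘ f) i
    ≡⟨ cong₂ _+_ (sum-cong-≗ jBlock-weight) (sum-cong-≗ iBlock-weight) ⟩
      ∑[ j < k ] (+ 2 + - (+ Tof S t j)) + ∑[ i < n ] (+ (3 ℕ.* Mof S i ℕ.+ 1 ℕ.+ selected i))
    ≡⟨ cong₂ _+_
         (trans (∑-distrib-+ (λ _ → + 2) (λ j → - (+ Tof S t j)))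
                (cong₂ _+_ (∑-const k 2) (trans (∑-neg k (λ j → + Tof S t j)) (cong -_ (∑-pos k (Tof S t))))))
         (trans (∑-pos n _) (cong +_ (trans (sumFin-+ n _ selected) (cong (sumFin n _ ℕ.+_) (sumFin-count n I))))) ⟩
      (+ (k ℕ.* 2) + - (+ B)) + + (A ℕ.+ ∣ I ∣)
    ≡⟨ cong (_+ + (A ℕ.+ ∣ I ∣)) (ℤP.+-comm (+ (k ℕ.* 2)) (- (+ B))) ⟩
      (- (+ B) + + (k ℕ.* 2)) + + (A ℕ.+ ∣ I ∣)
    ≡⟨ cong (_+_ (- (+ B) + + (k ℕ.* 2))) (ℤP.pos-+ A ∣ I ∣) ⟩
      (- (+ B) + + (k ℕ.* 2)) + (+ A + + ∣ I ∣)
    ≡⟨ ℤ-interchange (- (+ B)) (+ (k ℕ.* 2)) (+ A) (+ ∣ I ∣) ⟩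
      (- (+ B) + + A) + (+ (k ℕ.* 2) + + ∣ I ∣)
    ≡⟨ cong₂ _+_ (ℤP.+-comm (- (+ B)) (+ A)) (sym (ℤP.pos-+ (k ℕ.* 2) ∣ I ∣)) ⟩
      (+ A ℤ.- + B) + + (k ℕ.* 2 ℕ.+ ∣ I ∣)
    ≡⟨ cong (λ z → (+ A ℤ.- + B) + + (z ℕ.+ ∣ I ∣)) (ℕP.*-comm k 2) ⟩
      (+ A ℤ.- + B) + + (2 ℕ.* k ℕ.+ ∣ I ∣)
    ∎
    where
    open ≡-Reasoning
    A = sumFin n (λ i → 3 ℕ.* Mof S i ℕ.+ 1)
    B = sumFin k (Tof S t)

  weight-≤-kPrime : ∀ m → ∣ I ∣ ℕ.≤ m → weight G f ≤ kPrime k n m S t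
  weight-≤-kPrime m ∣I∣≤m = subst (_≤ kPrime k n m S t) (sym weight-value)
    (ℤP.+-monoʳ-≤ (+ sumFin n (λ i → 3 ℕ.* Mof S i ℕ.+ 1) ℤ.- + sumFin k (Tof S t))
      (+≤+ (ℕP.+-monoʳ-≤ (2 ℕ.* k) ∣I∣≤m)))

mainTheorem8 : (k n m : ℕ) (S : Fin n → Fin k → ℕ) (t : Fin k → ℕ)
    (C : (i : Fin n) → Fin k → Subset (Mof S i)) →
    (∀ i j → ∣ C i j ∣ ≡ S i j) →
    YesInstance k n m S t →
    Σ (V (buildG k n S t C) → Label) λ f →
      IsSRDF (buildG k n S t C) f × weight (buildG k n S t C) f ≤ kPrime k n m S t
mainTheorem8 k n m S t C ∣C∣≡S (I , ∣I∣≤m , covers) =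
  f , (dominating ∣C∣≡S covers , negatives-guarded) , weight-≤-kPrime m ∣I∣≤m
  where open Labelling S t C I
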